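{- Let $G=(V,A)$ be an Eulerian digraph, $s_1\neq s_2$ vertices of $G$, and $\mathcal{C}_1,\mathcal{C}_2$ the sets of recurrent configurations of the chip-firing game on $G$ with sink $s_1$, resp. $s_2$. For every $c\in\mathcal{C}_1$ and every $i\in\mathbb{N}$, $\left(\overline{c}^{\,i}\right)^{\circ s_2}$ restricted to $V\setminus\{s_2\}$ belongs to $\mathcal{C}_2$, and $\left(\overline{c}^{\,i}\right)^{\circ s_2}(s_2)\ge\deg^+_G(s_2)$.
   Context: All digraphs are finite multi-digraphs without loops; $\deg_G(u,w)$ is the number of arcs from $u$ to $w$, $\deg^\pm_G$ out/in-degree. $G$ is Eulerian if connected and $\deg^-_G(v)=\deg^+_G(v)$ for all $v$. Chip-firing game with sink $s$: configurations are maps $c:V\setminus\{s\}\to\mathbb{N}$; $v\neq s$ is firable if $c(v)\ge\deg^+_G(v)$; firing $v$ decreases $c(v)$ by $\deg^+_G(v)$ and increases $c(w)$ by $\deg_G(v,w)$ for $w\notin\{v,s\}$; $s$ never fires. Repeated firing gives a unique stable configuration $c^\circ$. A stable $c$ is recurrent if for every configuration $d$ there is a configuration $d'$ with $(d+d')^\circ=c$. For a map $x:V\to\mathbb{N}$ and a vertex $s$, $x^{\circ s}:V\to\mathbb{N}$ is obtained by repeatedly firing vertices $v\ne s$ with $x(v)\ge\deg^+_G(v)$, where firing $v$ decreases $x(v)$ by $\deg^+_G(v)$ and increases $x(w)$ by $\deg_G(v,w)$ for every $w\ne v$ (including $w=s$; chips on $s$ are kept), until no vertex other than $s$ is firable;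 this is well defined. For a configuration $c:V\setminus\{s_1\}\to\mathbb{N}$ and $i\in\mathbb{N}$, $\overline{c}^{\,i}:V\to\mathbb{N}$ equals $c$ on $V\setminus\{s_1\}$ and $\deg^+_G(s_1)+i$ at $s_1$. -}

module Defs where

open import Data.Nat using (ℕ; zero; suc; _+_; _∸_; _≤_; _<_)
open import Data.Fin using (Fin; zero; suc; _≟_; punchIn; punchOut)
open import Data.Product using (Σ; _×_; _,_; ∃)
open import Data.Sum using (_⊎_)
open import Relation.Nullary using (yes; no; ¬_)
open import Relation.Binary.PropositionalEquality using (_≡_; _≢_)

∑ : ∀ {n} → (Fin n → ℕ) → ℕ
∑ {zero}  f = 0
∑ {suc n} f = f zero + ∑ (λ j → f (suc j))

-- Finite multi-digraph without loops on vertex set Fin n;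
-- deg u w = number of arcs from u to w.
record Digraph (n : ℕ) : Set where
  field
    deg     : Fin n → Fin n → ℕ
    noLoops : ∀ v → deg v v ≡ 0

module _ {n : ℕ} (G : Digraph n) where
  open Digraph G

  outdeg : Fin n → ℕ
  outdeg v = ∑ (λ w → deg v w)

  indeg : Fin n → ℕ
  indeg v = ∑ (λ u → deg u v)

  data Reach : Fin n → Fin n → Set where
    here : ∀ {u} → Reach u u
    fwd  : ∀ {u v w} → 0 < deg u v → Reach v w → Reach u w
    bwd  : ∀ {u v w} → 0 < deg v u → Reach v w → Reach u w

  Connected : Set
  Connected = ∀ u w → Reach u w

  Eulerian : Set
  Eulerian = Connected × (∀ v → indeg v ≡ outdeg v)

  loss : Fin n → Fin n → ℕ
  loss v w with w ≟ v
  ... | yes _ = outdeg v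
  ... | no  _ = 0

  -- Maps x : V → ℕ, firing vertices other than s (chips on s kept)
  fireMap : (Fin n → ℕ) → Fin n → (Fin n → ℕ)
  fireMap x v w = (x w + deg v w) ∸ loss v w

  data MapStep (s : Fin n) (x : Fin n → ℕ) : (Fin n → ℕ) → Set where
    fire : ∀ v → v ≢ s → outdeg v ≤ x v → MapStep s x (fireMap x v)

  data MapSteps (s : Fin n) : (Fin n → ℕ) → (Fin n → ℕ) → Set where
    done : ∀ {x} → MapSteps s x x
    step : ∀ {x y z} → MapStep s x y → MapSteps s y z → MapSteps s x z

  MapStable : Fin n → (Fin n → ℕ) → Set
  MapStable s x = ∀ v → v ≢ s → x v < outdeg v

  StabAt : Fin n → (Fin n → ℕ) → (Fin n → ℕ) → Set
  StabAt s x y = Σ (Fin n → ℕ) λ z → MapSteps s x z × MapStable s z × (∀ v → z v ≡ y v)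

module _ {m : ℕ} (G : Digraph (suc m)) where
  open Digraph G

  -- A configuration with sink s: a map V ∖ {s} → ℕ, where V ∖ {s} is
  -- identified with Fin m via punchIn s.
  Config : Set
  Config = Fin m → ℕ

  fireConf : Fin (suc m) → Config → Fin m → Config
  fireConf s c i j = (c j + deg (punchIn s i) (punchIn s j)) ∸ loss G (punchIn s i) (punchIn s j)

  data ConfStep (s : Fin (suc m)) (c : Config) : Config → Set where
    fire : ∀ i → outdeg G (punchIn s i) ≤ c i → ConfStep s c (fireConf s c i)

  data ConfSteps (s : Fin (suc m)) : Config → Config → Set where
    done : ∀ {c} → ConfSteps s c c
    step : ∀ {c d e} → ConfStep s c d → ConfSteps s d e → ConfSteps s c e

  Stable : Fin (suc m) → Config → Set
  Stable s c = ∀ i → c i < outdeg G (punchIn s i)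

  Stabilizes : Fin (suc m) → Config → Config → Set
  Stabilizes s c d = Σ Config λ e → ConfSteps s c e × Stable s e × (∀ i → e i ≡ d i)

  Recurrent : Fin (suc m) → Config → Set
  Recurrent s c = Stable s c ×
    (∀ (d : Config) → ∃ λ (d' : Config) → Stabilizes s (λ i → d i + d' i) c)

  cbar : (s : Fin (suc m)) → Config → ℕ → (Fin (suc m) → ℕ)
  cbar s c i v with v ≟ s
  ... | yes _  = outdeg G s + i
  ... | no v≢s = c (punchOut {i = s} {j = v} (λ e → v≢s (Relation.Binary.PropositionalEquality.sym e)))

  restrict : (s : Fin (suc m)) → (Fin (suc m) → ℕ) → Config
  restrict s x j = x (punchIn s j)

module Submission where

-- Call U ⊆ V forbidden for a chip map y if every vertex of U holds fewer chips than
-- arcs it receives from U. If a legal firing sequence ends in a map in which U is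
-- forbidden, then the vertices of U that never fired form a nonempty forbidden set at
-- the start. Stabilizing c + deg⁺ back to the recurrent c fires every vertex but s₁,
-- so no nonempty set avoiding s₁ is forbidden in c; stabilizing c̄ⁱ to x fires s₁,
-- hence no nonempty set at all is forbidden in x. Taking U = V gives the bound on
-- x(s₂). For recurrence (Dhar's burning criterion on the Eulerian digraph): after one
-- firing of s₂, every other vertex fires once and x comes back (a vertex that cannot
-- fire would lie in a forbidden set). Growing a set along arcs entering it, which
-- exist because its complement is not forbidden, shows that firing s₂ often enough
-- loads every vertex with as many chips as desired; by the least action principle
-- such a loaded map still stabilizes to x.

open import Defs
open import Data.Bool using (Bool; true; false; T; T?; not; _∧_; _∨_; if_then_else_)
open import Data.Fin using (Fin; zero; suc; _≟_; punchIn; punchOut)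
open import Data.Fin.Properties using (any?; punchInᵢ≢i; punchIn-punchOut; punchOut-punchIn; punchOut-cong)
open import Data.Nat using (ℕ; zero; suc; _+_; _*_; _∸_; _≤_; _<_; z≤n; z<s; _≤?_; _<?_; _≡ᵇ_; _<ᵇ_; >-nonZero)
open import Data.Nat.Properties hiding (_≟_)
open import Algebra.Properties.CommutativeSemigroup +-commutativeSemigroup using (interchange; xy∙z≈xz∙y)
open import Data.Product using (Σ; _×_; _,_; ∃; proj₁)
open import Data.Sum using (_⊎_; inj₁; inj₂)
open import Function using (_∘_; _⇔_; mk⇔; Equivalence)
open import Relation.Nullary using (yes; no; ¬_; contradiction)
open import Relation.Nullary.Decidable using (_×-dec_; isYes; fromWitness; toWitness; decidable-stable; ¬?)
open import Relation.Binary.PropositionalEquality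

∑-cong : ∀ {n} {f g : Fin n → ℕ} → f ≗ g → ∑ f ≡ ∑ g
∑-cong {zero}  f≗g = refl
∑-cong {suc n} f≗g = cong₂ _+_ (f≗g zero) (∑-cong (f≗g ∘ suc))

∑-mono : ∀ {n} {f g : Fin n → ℕ} → (∀ i → f i ≤ g i) → ∑ f ≤ ∑ g
∑-mono {zero}  f≤g = z≤n
∑-mono {suc n} f≤g = +-mono-≤ (f≤g zero) (∑-mono (f≤g ∘ suc))

∑-mono-< : ∀ {n} {f g : Fin n → ℕ} → (∀ i → f i ≤ g i) → ∀ i → f i < g i → ∑ f < ∑ g
∑-mono-< f≤g zero    lt = +-mono-<-≤ lt (∑-mono (f≤g ∘ suc))
∑-mono-< f≤g (suc i) lt = +-mono-≤-< (f≤g zero) (∑-mono-< (f≤g ∘ suc) i lt)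

∑-+ : ∀ {n} (f g : Fin n → ℕ) → ∑ (λ i → f i + g i) ≡ ∑ f + ∑ g
∑-+ {zero}  f g = refl
∑-+ {suc n} f g = trans (cong (f zero + g zero +_) (∑-+ (f ∘ suc) (g ∘ suc)))
                        (interchange (f zero) (g zero) _ _)

∑-zero : ∀ {n} → ∑ {n} (λ _ → 0) ≡ 0
∑-zero {zero}  = refl
∑-zero {suc n} = ∑-zero {n}

≤-∑ : ∀ {n} (f : Fin n → ℕ) i → f i ≤ ∑ f
≤-∑ f zero    = m≤m+n _ _
≤-∑ f (suc i) = ≤-trans (≤-∑ (f ∘ suc) i) (m≤n+m _ _)

∑-pos : ∀ {n} (f : Fin n → ℕ) → 0 < ∑ f → ∃ λ i → 0 < f i
∑-pos {suc n} f pos with f zero in eq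
... | suc _ = zero , subst (0 <_) (sym eq) z<s
... | zero  with ∑-pos (f ∘ suc) pos
...   | i , fi>0 = suc i , fi>0

δ : ∀ {n} → Fin n → Fin n → ℕ
δ zero    zero    = 1
δ zero    (suc _) = 0
δ (suc _) zero    = 0
δ (suc v) (suc w) = δ v w

δ-refl : ∀ {n} (v : Fin n) → δ v v ≡ 1
δ-refl zero    = refl
δ-refl (suc v) = δ-refl v

δ-≢ : ∀ {n} {v w : Fin n} → v ≢ w → δ v w ≡ 0
δ-≢ {v = zero}  {zero}  v≢w = contradiction refl v≢w
δ-≢ {v = zero}  {suc w} v≢w = refl
δ-≢ {v = suc v} {zero}  v≢w = refl
δ-≢ {v = suc v} {suc w} v≢w = δ-≢ (v≢w ∘ cong suc)

∑-δ : ∀ {n} (v : Fin n) (h : Fin n → ℕ) → ∑ (λ u → δ v u * h u) ≡ h v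
∑-δ {suc n} zero    h = trans (cong (h zero + 0 +_) (∑-zero {n})) (trans (+-identityʳ _) (+-identityʳ _))
∑-δ {suc n} (suc v) h = ∑-δ v (h ∘ suc)

δ≡0⇒≢ : ∀ {n} {v w : Fin n} → δ v w ≡ 0 → v ≢ w
δ≡0⇒≢ {v = v} δvv≡0 refl = contradiction (trans (sym (δ-refl v)) δvv≡0) (λ ())

δ≤ : ∀ {n} {v : Fin n} {r : Fin n → ℕ} → 0 < r v → ∀ w → δ v w ≤ r w
δ≤ {v = v} {r} 0<rv w with v ≟ w
... | yes refl = subst (_≤ r v) (sym (δ-refl v)) 0<rv
... | no v≢w   = subst (_≤ r w) (sym (δ-≢ v≢w)) z≤n

δ-split : ∀ {n} {v : Fin n} {r : Fin n → ℕ} → 0 < r v → ∀ w → δ v w + (r w ∸ δ v w) ≡ r w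
δ-split {v = v} {r} 0<rv w = m+[n∸m]≡n (δ≤ {v = v} {r} 0<rv w)

if-≤ : ∀ b k → (if b then k else 0) ≤ k
if-≤ true  k = ≤-refl
if-≤ false k = z≤n

if-pos : ∀ b {k} → 0 < (if b then k else 0) → T b × 0 < k
if-pos true 0<k = _ , 0<k

if-false-pos : ∀ b → ¬ T b → 0 < (if b then 0 else 1)
if-false-pos false _  = z<s
if-false-pos true  ¬b = contradiction _ ¬b

T-not : ∀ {b} → ¬ T b → T (not b)
T-not {false} _  = _
T-not {true}  ¬b = ¬b _

T-not⁻ : ∀ {b} → T (not b) → ¬ T b
T-not⁻ {false} _ ()

T-∨ʳ : ∀ {a b} → T b → T (a ∨ b)
T-∨ʳ {true}  _ = _
T-∨ʳ {false} p = p

m≤o<m+n⇒0<n : ∀ {m n o} → m ≤ o → o < m + n → 0 < n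
m≤o<m+n⇒0<n {m} {zero}  m≤o o<m+0 = contradiction m≤o (<⇒≱ (subst (_ <_) (+-identityʳ m) o<m+0))
m≤o<m+n⇒0<n {n = suc _} _ _ = z<s

module Firing {n : ℕ} (G : Digraph n) where
  open Digraph G

  Chips : Set
  Chips = Fin n → ℕ

  out : Fin n → ℕ
  out = outdeg G

  -- Endpoints are related pointwise, since maps agree only propositionally after firing.
  data Run : Chips → Chips → Set where
    stop : ∀ {a b} → a ≗ b → Run a b
    fire : ∀ {a b} v → out v ≤ a v → Run (fireMap G a v) b → Run a b

  firings : ∀ {a b} → Run a b → Chips
  firings (stop _)     w = 0
  firings (fire v _ ρ) w = δ v w + firings ρ w

  fireMap-cong : ∀ {a a'} → a ≗ a' → ∀ v → fireMap G a v ≗ fireMap G a' v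
  fireMap-cong a≗a' v w = cong (λ k → (k + deg v w) ∸ loss G v w) (a≗a' w)

  Run-respˡ : ∀ {a a' b} → a ≗ a' → Run a b → Run a' b
  Run-respˡ a≗a' (stop a≗b)    = stop (λ w → trans (sym (a≗a' w)) (a≗b w))
  Run-respˡ a≗a' (fire v le ρ) =
    fire v (subst (out v ≤_) (a≗a' v) le) (Run-respˡ (fireMap-cong a≗a' v) ρ)

  firings-respˡ : ∀ {a a' b} (a≗a' : a ≗ a') (ρ : Run a b) → firings (Run-respˡ a≗a' ρ) ≗ firings ρ
  firings-respˡ a≗a' (stop _)      w = refl
  firings-respˡ a≗a' (fire v le ρ) w = cong (δ v w +_) (firings-respˡ (fireMap-cong a≗a' v) ρ w)

  _++_ : ∀ {a b c} → Run a b → Run b c → Run a c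
  stop a≗b    ++ σ = Run-respˡ (sym ∘ a≗b) σ
  fire v le ρ ++ σ = fire v le (ρ ++ σ)

  firings-++ : ∀ {a b c} (ρ : Run a b) (σ : Run b c) → ∀ w → firings (ρ ++ σ) w ≡ firings ρ w + firings σ w
  firings-++ (stop a≗b)    σ w = firings-respˡ (sym ∘ a≗b) σ w
  firings-++ (fire v le ρ) σ w = trans (cong (δ v w +_) (firings-++ ρ σ w)) (sym (+-assoc (δ v w) _ _))

  fire-balance : ∀ {a} v → out v ≤ a v → ∀ w → fireMap G a v w + δ v w * out w ≡ a w + deg v w
  fire-balance {a} v le w with w ≟ v
  ... | yes refl rewrite noLoops w | δ-refl w | +-identityʳ (a w) | +-identityʳ (out w) = m∸n+n≡m le
  ... | no w≢v   rewrite δ-≢ (w≢v ∘ sym) = +-identityʳ _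

  fireMap-+ : ∀ {a} v → out v ≤ a v → ∀ (e : Chips) w → fireMap G (λ u → a u + e u) v w ≡ fireMap G a v w + e w
  fireMap-+ {a} v le e w with w ≟ v
  ... | yes refl rewrite noLoops w | +-identityʳ (a w) | +-identityʳ (a w + e w) = +-∸-comm (e w) le
  ... | no _     = xy∙z≈xz∙y (a w) (e w) (deg v w)

  received : Chips → Chips
  received f w = ∑ (λ u → f u * deg u w)

  received-cong : ∀ {f g} → f ≗ g → received f ≗ received g
  received-cong f≗g w = ∑-cong (λ u → cong (_* deg u w) (f≗g u))

  received-+ : ∀ f g w → received (λ u → f u + g u) w ≡ received f w + received g w
  received-+ f g w =
    trans (∑-cong (λ u → *-distribʳ-+ (deg u w) (f u) (g u))) (∑-+ (λ u → f u * deg u w) (λ u → g u * deg u w))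

  received-δ : ∀ v w → received (δ v) w ≡ deg v w
  received-δ v w = ∑-δ v (λ u → deg u w)

  received-δ* : ∀ v B w → received (λ u → δ v u * B) w ≡ B * deg v w
  received-δ* v B w = trans (∑-cong (λ u → *-assoc (δ v u) B (deg u w))) (∑-δ v (λ u → B * deg u w))

  -- b is what firing every vertex u exactly f u times turns a into, legal or not.
  Outcome : Chips → Chips → Chips → Set
  Outcome a f b = ∀ w → b w + f w * out w ≡ a w + received f w

  Outcome-cong : ∀ {a f g b} → f ≗ g → Outcome a f b → Outcome a g b
  Outcome-cong {a} {f} {g} {b} f≗g o w =
    subst₂ (λ k l → b w + k * out w ≡ a w + l) (f≗g w) (received-cong f≗g w) (o w)

  Outcome-unique : ∀ {a f b b'} → Outcome a f b → Outcome a f b' → b ≗ b'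
  Outcome-unique {f = f} o o' w = +-cancelʳ-≡ (f w * out w) _ _ (trans (o w) (sym (o' w)))

  Outcome-fire : ∀ {a f b} v → out v ≤ a v →
                 Outcome (fireMap G a v) f b ⇔ Outcome a (λ w → δ v w + f w) b
  Outcome-fire {a} {f} {b} v le = mk⇔ (λ o w → trans (lhs w) (trans (cong (_+ δ v w * out w) (o w)) (sym (rhs w))))
                                      (λ o w → +-cancelʳ-≡ (δ v w * out w) _ _ (trans (sym (lhs w)) (trans (o w) (rhs w))))
    where
      open ≡-Reasoning
      a' : Chips
      a' = fireMap G a v
      lhs : ∀ w → b w + (δ v w + f w) * out w ≡ (b w + f w * out w) + δ v w * out w
      lhs w = trans (cong (b w +_) (trans (*-distribʳ-+ (out w) (δ v w) (f w)) (+-comm (δ v w * out w) _)))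
                    (sym (+-assoc (b w) _ _))
      rhs : ∀ w → a w + received (λ u → δ v u + f u) w ≡ (a' w + received f w) + δ v w * out w
      rhs w = begin
        a w + received (λ u → δ v u + f u) w  ≡⟨ cong (a w +_) (trans (received-+ (δ v) f w) (cong (_+ received f w) (received-δ v w))) ⟩
        a w + (deg v w + received f w)         ≡⟨ sym (+-assoc (a w) _ _) ⟩
        (a w + deg v w) + received f w         ≡⟨ cong (_+ received f w) (sym (fire-balance v le w)) ⟩
        (a' w + δ v w * out w) + received f w  ≡⟨ xy∙z≈xz∙y (a' w) (δ v w * out w) _ ⟩
        (a' w + received f w) + δ v w * out w  ∎

  state-equation : ∀ {a b} (ρ : Run a b) → Outcome a (firings ρ) b
  state-equation {a} (stop a≗b) w =
    trans (+-identityʳ _) (trans (sym (a≗b w)) (sym (trans (cong (a w +_) (∑-zero {n})) (+-identityʳ _))))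
  state-equation (fire v le ρ) = Equivalence.to (Outcome-fire v le) (state-equation ρ)

  unfired-outcome : ∀ {a b} (ρ : Run a b) {v} → firings ρ v ≡ 0 → b v ≡ a v + received (firings ρ) v
  unfired-outcome {b = b} ρ {v} unfired =
    trans (sym (+-identityʳ (b v))) (trans (cong (λ k → b v + k * out v) (sym unfired)) (state-equation ρ v))

  unfired-gains : ∀ {a b} (ρ : Run a b) {v} → firings ρ v ≡ 0 → a v ≤ b v
  unfired-gains ρ unfired = subst (_ ≤_) (sym (unfired-outcome ρ unfired)) (m≤m+n _ _)

  shift : ∀ {a b} (ρ : Run a b) (e : Chips) →
          Σ (Run (λ w → a w + e w) (λ w → b w + e w)) λ ρ' → firings ρ' ≗ firings ρ
  shift (stop a≗b) e = stop (λ w → cong (_+ e w) (a≗b w)) , λ w → refl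
  shift (fire v le ρ) e with shift ρ e
  ... | ρ' , same = fire v (≤-trans le (m≤m+n _ _)) (Run-respˡ (sym ∘ fireMap-+ v le e) ρ') ,
                    λ w → cong (δ v w +_) (trans (firings-respˡ (sym ∘ fireMap-+ v le e) ρ' w) (same w))

  fire-repeatedly : ∀ u B {a} → B * out u ≤ a u →
                    Σ Chips λ b → Σ (Run a b) λ ρ → firings ρ ≗ λ w → δ u w * B
  fire-repeatedly u zero    {a} _  = a , stop (λ _ → refl) , λ w → sym (*-zeroʳ (δ u w))
  fire-repeatedly u (suc B) {a} le with fire-repeatedly u B {fireMap G a u} (+-cancelʳ-≤ (out u) _ _ le')
    where
      balance : fireMap G a u u + out u ≡ a u
      balance = begin
        fireMap G a u u + out u            ≡⟨ cong (fireMap G a u u +_) (sym (trans (cong (_* out u) (δ-refl u)) (*-identityˡ (out u)))) ⟩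
        fireMap G a u u + δ u u * out u    ≡⟨ fire-balance {a} u (≤-trans (m≤m+n _ _) le) u ⟩
        a u + deg u u                      ≡⟨ cong (a u +_) (noLoops u) ⟩
        a u + 0                            ≡⟨ +-identityʳ (a u) ⟩
        a u                                ∎
        where open ≡-Reasoning
      le' : B * out u + out u ≤ fireMap G a u u + out u
      le' = subst₂ _≤_ (+-comm (out u) _) (sym balance) le
  ... | b , ρ , count = b , fire u (≤-trans (m≤m+n _ _) le) ρ ,
                        λ w → trans (cong (δ u w +_) (count w)) (sym (*-suc (δ u w) B))

  least-action : ∀ {a b} (π : Run a b) {g y} → Outcome a g y →
                 (∀ v → g v < firings π v → y v < out v) → ∀ v → firings π v ≤ g v
  least-action (stop _) _ _ _ = z≤n
  least-action {a} (fire v le π) {g} {y} o y-stable with g v in gv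
  ... | zero  = contradiction (y-stable v short) (≤⇒≯ out≤y)
    where
      short : g v < δ v v + firings π v
      short rewrite gv | δ-refl v = z<s
      out≤y : out v ≤ y v
      out≤y = begin
        out v                    ≤⟨ le ⟩
        a v                      ≤⟨ m≤m+n (a v) _ ⟩
        a v + received g v       ≡⟨ sym (o v) ⟩
        y v + g v * out v        ≡⟨ cong (λ k → y v + k * out v) gv ⟩
        y v + 0                  ≡⟨ +-identityʳ (y v) ⟩
        y v                      ∎
        where open ≤-Reasoning
  ... | suc _ = λ w → subst (δ v w + firings π w ≤_) (split w) (+-monoʳ-≤ (δ v w) (rest w))
    where
      g' : Chips
      g' w = g w ∸ δ v w
      split : ∀ w → δ v w + g' w ≡ g w
      split = δ-split {r = g} (subst (0 <_) (sym gv) z<s)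
      rest : ∀ w → firings π w ≤ g' w
      rest = least-action π (Equivalence.from (Outcome-fire v le) (Outcome-cong (sym ∘ split) o))
               (λ w lt → y-stable w (subst (_< δ v w + firings π w) (split w) (+-monoʳ-< (δ v w) lt)))

  -- Opaque: callers use only the specification, and unfolding the search makes
  -- with-abstractions over results built from it very slow.
  opaque
    maximal-run : ∀ fuel a (r : Chips) → ∑ r ≤ fuel →
                  Σ Chips λ b → Σ (Run a b) λ ρ →
                    (∀ v → firings ρ v ≤ r v) × (∀ v → firings ρ v < r v → b v < out v)
    maximal-run fuel a r ∑r≤fuel with any? (λ v → (0 <? r v) ×-dec (out v ≤? a v))
    ... | no stuck = a , stop (λ _ → refl) , (λ _ → z≤n) , λ v 0<rv → ≰⇒> (λ le → stuck (v , 0<rv , le))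
    ... | yes (v , 0<rv , le) with fuel
    ...   | zero      = contradiction ∑r≤fuel (<⇒≱ (<-≤-trans 0<rv (≤-∑ r v)))
    ...   | suc fuel' with maximal-run fuel' (fireMap G a v) r' (≤-pred (≤-trans ∑r'<∑r ∑r≤fuel))
      where
        r' : Chips
        r' w = r w ∸ δ v w
        ∑r'<∑r : ∑ r' < ∑ r
        ∑r'<∑r = ∑-mono-< (λ w → m∸n≤m (r w) (δ v w)) v
                   (∸-monoʳ-< (subst (0 <_) (sym (δ-refl v)) z<s) (δ≤ {v = v} {r} 0<rv v))
    ...     | b , ρ , within , maximal =
      b , fire v le ρ ,
      (λ w → subst (δ v w + firings ρ w ≤_) (split w) (+-monoʳ-≤ (δ v w) (within w))) ,
      (λ w lt → maximal w (+-cancelˡ-< (δ v w) _ _ (subst (δ v w + firings ρ w <_) (sym (split w)) lt)))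
      where
        split : ∀ w → δ v w + (r w ∸ δ v w) ≡ r w
        split = δ-split {r = r} 0<rv

  -- Stabilization is confluent: by the least action principle, no legal run from a
  -- that avoids t overshoots ρ, so the maximal run below ρ's firing vector catches up.
  extend-to-stable : ∀ {t a y b} (ρ : Run a y) → firings ρ t ≡ 0 → (∀ v → v ≢ t → y v < out v) →
                 (π : Run a b) → firings π t ≡ 0 →
                 Σ Chips λ y' → Σ (Run b y') λ σ → firings σ t ≡ 0 × y' ≗ y
  extend-to-stable {t} {a} {y} {b} ρ ρt y-stable π πt
    with maximal-run _ b (λ w → firings ρ w ∸ firings π w) ≤-refl
  ... | y' , σ , within , maximal = y' , σ , σt , Outcome-unique {f = firings ρ} (Outcome-cong total τ-outcome) (state-equation ρ)
    where
      π≤ρ : ∀ v → firings π v ≤ firings ρ v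
      π≤ρ = least-action π (state-equation ρ) y-stable'
        where
          y-stable' : ∀ v → firings ρ v < firings π v → y v < out v
          y-stable' v lt with v ≟ t
          ... | yes refl = contradiction (subst (firings ρ v <_) πt lt) (λ ())
          ... | no v≢t   = y-stable v v≢t
      split : ∀ v → firings π v + (firings ρ v ∸ firings π v) ≡ firings ρ v
      split v = m+[n∸m]≡n (π≤ρ v)
      τ-outcome : Outcome a (λ w → firings π w + firings σ w) y'
      τ-outcome = Outcome-cong (firings-++ π σ) (state-equation (π ++ σ))
      ρ≤τ : ∀ v → firings ρ v ≤ firings π v + firings σ v
      ρ≤τ = least-action ρ τ-outcome λ v lt →
              maximal v (+-cancelˡ-< (firings π v) _ _ (subst (_ <_) (sym (split v)) lt))
      total : ∀ v → firings π v + firings σ v ≡ firings ρ v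
      total v = ≤-antisym (subst (_ ≤_) (split v) (+-monoʳ-≤ (firings π v) (within v))) (ρ≤τ v)
      σt : firings σ t ≡ 0
      σt = n≤0⇒n≡0 (≤-trans (within t) (≤-reflexive (trans (cong (_∸ firings π t) ρt) (0∸n≡0 (firings π t)))))

  inflow : (Fin n → Bool) → Fin n → ℕ
  inflow U v = ∑ (λ u → if U u then deg u v else 0)

  inflow-pos : ∀ U v → 0 < inflow U v → ∃ λ u → T (U u) × 0 < deg u v
  inflow-pos U v pos with ∑-pos (λ u → if U u then deg u v else 0) pos
  ... | u , p = u , if-pos (U u) p

  inflow-complement : ∀ U v → inflow (not ∘ U) v + inflow U v ≡ indeg G v
  inflow-complement U v =
    trans (sym (∑-+ (λ u → if not (U u) then deg u v else 0) (λ u → if U u then deg u v else 0))) (∑-cong split)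
    where
      split : ∀ u → (if not (U u) then deg u v else 0) + (if U u then deg u v else 0) ≡ deg u v
      split u with U u
      ... | true  = refl
      ... | false = +-identityʳ (deg u v)

  Forbidden : Chips → (Fin n → Bool) → Set
  Forbidden y U = ∀ v → T (U v) → y v < inflow U v

  Forbidden-resp : ∀ {a b U} → (∀ v → T (U v) → a v ≡ b v) → Forbidden a U → Forbidden b U
  Forbidden-resp {U = U} a≡b F v p = subst (_< inflow U v) (a≡b v p) (F v p)

  unfired : (Fin n → Bool) → Chips → Fin n → Bool
  unfired U f v = (f v ≡ᵇ 0) ∧ U v

  unfired⁻ : ∀ {U f v} → T (unfired U f v) → f v ≡ 0 × T (U v)
  unfired⁻ {f = f} {v} p with f v
  ... | zero = refl , p

  unfired-δ : ∀ U f v {w} → δ v w ≡ 0 → unfired U (λ u → δ v u + f u) w ≡ unfired U f w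
  unfired-δ U f v {w} δvw≡0 = cong (λ k → ((k + f w) ≡ᵇ 0) ∧ U w) δvw≡0

  forbidden-backward : ∀ {a b U} (ρ : Run a b) → Forbidden b U → Forbidden a (unfired U (firings ρ))
  forbidden-backward {U = U} (stop a≗b) F v p = subst (_< inflow U v) (sym (a≗b v)) (F v p)
  forbidden-backward {a} {U = U} (fire v le ρ) F u p =
    +-cancelʳ-< (deg v u) (a u) _ (begin-strict
      a u + deg v u                       ≡⟨ sym (fire-balance v le u) ⟩
      a' u + δ v u * out u                ≡⟨ cong (λ k → a' u + k * out u) δvu≡0 ⟩
      a' u + 0                            ≡⟨ +-identityʳ (a' u) ⟩
      a' u                                <⟨ forbidden-backward ρ F u (subst T (unfired-δ U (firings ρ) v δvu≡0) p) ⟩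
      inflow U' u                         ≤⟨ ∑-mono bound ⟩
      ∑ (λ w → (if U'' w then deg w u else 0) + δ v w * deg w u)
                                          ≡⟨ ∑-+ (λ w → if U'' w then deg w u else 0) _ ⟩
      inflow U'' u + received (δ v) u     ≡⟨ cong (inflow U'' u +_) (received-δ v u) ⟩
      inflow U'' u + deg v u              ∎)
    where
      open ≤-Reasoning
      a' : Chips
      a' = fireMap G a v
      U' U'' : Fin n → Bool
      U' = unfired U (firings ρ)
      U'' = unfired U (λ w → δ v w + firings ρ w)
      δvu≡0 : δ v u ≡ 0
      δvu≡0 = m+n≡0⇒m≡0 (δ v u) (proj₁ (unfired⁻ {U} {λ w → δ v w + firings ρ w} p))
      bound : ∀ w → (if U' w then deg w u else 0) ≤ (if U'' w then deg w u else 0) + δ v w * deg w u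
      bound w with v ≟ w
      ... | yes refl = ≤-trans (if-≤ (U' w) (deg w u))
                         (≤-trans (≤-reflexive (sym (trans (cong (_* deg w u) (δ-refl w)) (*-identityˡ _))))
                                  (m≤n+m _ _))
      ... | no v≢w rewrite δ-≢ v≢w = m≤m+n _ _

  forbidden-nonempty : ∀ {a b U} (ρ : Run a b) → Forbidden b U →
                       ∃ (λ v → T (U v)) → ∃ λ v → T (unfired U (firings ρ) v)
  forbidden-nonempty (stop _) F nonempty = nonempty
  forbidden-nonempty {U = U} (fire v le ρ) F nonempty with forbidden-nonempty ρ F nonempty
  ... | u , p with v ≟ u
  ...   | no v≢u   = u , subst T (sym (unfired-δ U (firings ρ) v (δ-≢ v≢u))) p
  ...   | yes refl with inflow-pos _ v (≤-<-trans z≤n (forbidden-backward ρ F v p))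
  ...     | w , q , arc = w , subst T (sym (unfired-δ U (firings ρ) v (δ-≢ v≢w))) q
    where
      v≢w : v ≢ w
      v≢w refl = <-irrefl (sym (noLoops v)) arc

module Sink {m : ℕ} (G : Digraph (suc m)) where
  open Digraph G
  open Firing G

  off-sink : ∀ (s : Fin (suc m)) {v} → v ≢ s → ∃ λ j → punchIn s j ≡ v
  off-sink s v≢s = punchOut (v≢s ∘ sym) , punchIn-punchOut (v≢s ∘ sym)

  fireConf-fireMap : ∀ s {c} M i → (∀ j → c j ≡ M (punchIn s j)) →
                     ∀ j → fireConf G s c i j ≡ fireMap G M (punchIn s i) (punchIn s j)
  fireConf-fireMap s M i c≡M j = cong (λ k → (k + deg (punchIn s i) (punchIn s j)) ∸ loss G (punchIn s i) (punchIn s j)) (c≡M j)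

  confSteps⇒run : ∀ {s c e} → ConfSteps G s c e → ∀ M → (∀ j → c j ≡ M (punchIn s j)) →
         Σ Chips λ N → Σ (Run M N) λ ρ → firings ρ s ≡ 0 × (∀ j → e j ≡ N (punchIn s j))
  confSteps⇒run done M c≡M = M , stop (λ _ → refl) , refl , c≡M
  confSteps⇒run {s} (step (fire i le) steps) M c≡M with confSteps⇒run steps (fireMap G M (punchIn s i)) (fireConf-fireMap s M i c≡M)
  ... | N , ρ , ρs , e≡N = N , fire (punchIn s i) (subst (out (punchIn s i) ≤_) (c≡M i) le) ρ ,
                           trans (cong (_+ firings ρ s) (δ-≢ (punchInᵢ≢i s i))) ρs , e≡N

  run⇒confSteps : ∀ {t M N} (ρ : Run M N) → firings ρ t ≡ 0 → ∀ c → (∀ j → c j ≡ M (punchIn t j)) →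
          Σ (Config G) λ e → ConfSteps G t c e × (∀ j → e j ≡ N (punchIn t j))
  run⇒confSteps (stop M≗N) _ c c≡M = c , done , λ j → trans (c≡M j) (M≗N _)
  run⇒confSteps {t} {M} (fire v le ρ) ρt c c≡M with off-sink t (δ≡0⇒≢ {v = v} {t} (m+n≡0⇒m≡0 (δ v t) ρt))
  ... | i , refl with run⇒confSteps ρ (m+n≡0⇒n≡0 (δ v t) ρt) (fireConf G t c i) (fireConf-fireMap t M i c≡M)
  ...   | e , steps , e≡N = e , step (fire i (subst (out v ≤_) (sym (c≡M i)) le)) steps , e≡N

  mapSteps⇒run : ∀ {s x z} → MapSteps G s x z → Σ (Run x z) λ ρ → firings ρ s ≡ 0
  mapSteps⇒run done = stop (λ _ → refl) , refl
  mapSteps⇒run {s} (step (fire v v≢s le) steps) with mapSteps⇒run steps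
  ... | ρ , ρs = fire v le ρ , trans (cong (_+ firings ρ s) (δ-≢ v≢s)) ρs

  cbar-punchIn : ∀ s (c : Config G) k j → cbar G s c k (punchIn s j) ≡ c j
  cbar-punchIn s c k j with punchIn s j ≟ s
  ... | yes eq = contradiction eq (punchInᵢ≢i s j)
  ... | no _   = cong c (trans (punchOut-cong s refl) (punchOut-punchIn s))

  cbar-sink : ∀ s (c : Config G) k → cbar G s c k s ≡ out s + k
  cbar-sink s c k with s ≟ s
  ... | yes _   = refl
  ... | no s≢s  = contradiction refl s≢s

  recurrent-unforbidden : ∀ {s c M U} → Recurrent G s c → (∀ j → M (punchIn s j) ≡ c j) →
                          ¬ T (U s) → ∃ (λ v → T (U v)) → ¬ Forbidden M U
  recurrent-unforbidden {s} {c} {M} {U} (_ , reachable) M≡c s∉U nonempty F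
    with reachable (λ j → out (punchIn s j))
  ... | d' , e , steps , e-stable , e≡c
    with confSteps⇒run steps (cbar G s _ 0) (λ j → sym (cbar-punchIn s _ 0 j))
  ...   | N , ρ , _ , e≡N = all-fired (forbidden-nonempty ρ (Forbidden-resp M≡N F) nonempty)
    where
      loaded : Config G
      loaded j = out (punchIn s j) + d' j
      off-s : ∀ {v} → T (U v) → ∃ λ j → punchIn s j ≡ v
      off-s {v} v∈U = off-sink s {v} (λ { refl → s∉U v∈U })
      M≡N : ∀ v → T (U v) → M v ≡ N v
      M≡N v v∈U with off-s v∈U
      ... | j , refl = trans (M≡c j) (trans (sym (e≡c j)) (e≡N j))
      all-fired : ¬ ∃ (λ v → T (unfired U (firings ρ) v))
      all-fired (v , p) with unfired⁻ {U} {firings ρ} p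
      ... | v-unfired , v∈U with off-s v∈U
      ...   | j , refl = <⇒≱ (subst (_< out v) (e≡N j) (e-stable j)) (begin
        out v                  ≤⟨ m≤m+n (out v) (d' j) ⟩
        loaded j               ≡⟨ sym (cbar-punchIn s loaded 0 j) ⟩
        cbar G s loaded 0 v    ≤⟨ unfired-gains ρ v-unfired ⟩
        N v                    ∎)
        where open ≤-Reasoning

module BurningCriterion {m : ℕ} (G : Digraph (suc m)) (in≡out : ∀ v → indeg G v ≡ outdeg G v)
                       (t : Fin (suc m)) (x : Firing.Chips G)
                       (x-stable : ∀ v → v ≢ t → x v < outdeg G v)
                       (x-unforbidden : ∀ U → ∃ (λ v → T (U v)) → ¬ Firing.Forbidden G x U) where
  open Digraph G
  open Firing G
  open Sink G

  opaque
    unforbidden-witness : ∀ U → ∃ (λ v → T (U v)) → ∃ λ v → T (U v) × inflow U v ≤ x v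
    unforbidden-witness U nonempty with any? (λ v → T? (U v) ×-dec (inflow U v ≤? x v))
    ... | yes witness = witness
    ... | no none     = contradiction (λ v v∈U → ≰⇒> (λ le → none (v , v∈U , le))) (x-unforbidden U nonempty)

  sink-loaded : out t ≤ x t
  sink-loaded with out t ≤? x t
  ... | yes le = le
  ... | no  lt = contradiction forbidden (x-unforbidden (λ _ → true) (t , _))
    where
      forbidden : Forbidden x (λ _ → true)
      forbidden v _ with v ≟ t
      ... | yes refl = subst (x t <_) (sym (in≡out t)) (≰⇒> lt)
      ... | no v≢t   = subst (x v <_) (sym (in≡out v)) (x-stable v v≢t)

  once : Chips
  once v = 1 ∸ δ t v

  once-sink : once t ≡ 0
  once-sink = cong (1 ∸_) (δ-refl t)

  once-≢ : ∀ {v} → v ≢ t → once v ≡ 1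
  once-≢ v≢t = cong (1 ∸_) (δ-≢ (v≢t ∘ sym))

  -- Firing every vertex once returns every chip, as in = out.
  received-once : ∀ v → deg t v + received once v ≡ out v
  received-once v = begin
    deg t v + received once v             ≡⟨ cong (_+ received once v) (sym (received-δ t v)) ⟩
    received (δ t) v + received once v    ≡⟨ sym (received-+ (δ t) once v) ⟩
    received (λ u → δ t u + once u) v     ≡⟨ received-cong (δ-split {v = t} {λ _ → 1} z<s) v ⟩
    received (λ _ → 1) v                  ≡⟨ ∑-cong (λ u → *-identityˡ (deg u v)) ⟩
    indeg G v                             ≡⟨ in≡out v ⟩
    out v                                 ∎
    where open ≡-Reasoning

  -- Dhar's burning algorithm: the vertices that never fire would be forbidden in x.
  burn : ∀ {A} → (∀ v → v ≢ t → A v ≡ x v + deg t v) →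
         Σ Chips λ b → Σ (Run A b) λ ρ → firings ρ ≗ once × (∀ v → v ≢ t → b v ≡ x v)
  burn {A} A≡ with maximal-run _ A once ≤-refl
  ... | b , ρ , within , maximal = b , ρ , all-once , b≡x
    where
      f : Chips
      f = firings ρ
      unburnt : Fin (suc m) → Bool
      unburnt w = f w <ᵇ once w
      covered : ∀ u w → deg w u ≤ (δ t w * deg w u + f w * deg w u) + (if unburnt w then deg w u else 0)
      covered u w with t ≟ w
      ... | yes refl rewrite δ-refl w = ≤-trans (m≤m+n (deg w u) 0) (≤-trans (m≤m+n _ _) (m≤m+n _ _))
      ... | no t≢w rewrite δ-≢ t≢w with f w
      ...   | zero  = ≤-refl
      ...   | suc k = ≤-trans (m≤m+n (deg w u) (k * deg w u)) (m≤m+n _ _)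
      indeg-bound : ∀ u → indeg G u ≤ (deg t u + received f u) + inflow unburnt u
      indeg-bound u = ≤-trans (∑-mono (covered u)) (≤-reflexive (trans
        (∑-+ (λ w → δ t w * deg w u + f w * deg w u) (λ w → if unburnt w then deg w u else 0))
        (cong (_+ inflow unburnt u) (trans (∑-+ (λ w → δ t w * deg w u) (λ w → f w * deg w u))
                                           (cong (_+ received f u) (received-δ t u))))))
      forbidden : Forbidden x unburnt
      forbidden u u-unburnt = +-cancelʳ-< (out u) (x u) _ (begin-strict
        x u + out u                                          ≡⟨ cong (x u +_) (sym (in≡out u)) ⟩
        x u + indeg G u                                      ≤⟨ +-monoʳ-≤ (x u) (indeg-bound u) ⟩
        x u + ((deg t u + received f u) + inflow unburnt u)  ≡⟨ sym (+-assoc (x u) _ _) ⟩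
        (x u + (deg t u + received f u)) + inflow unburnt u  ≡⟨ cong (_+ inflow unburnt u) reaches-b ⟩
        b u + inflow unburnt u                               <⟨ +-monoˡ-< (inflow unburnt u) (maximal u lt) ⟩
        out u + inflow unburnt u                             ≡⟨ +-comm (out u) _ ⟩
        inflow unburnt u + out u                             ∎)
        where
          open ≤-Reasoning
          lt : f u < once u
          lt = <ᵇ⇒< (f u) (once u) u-unburnt
          u≢t : u ≢ t
          u≢t refl = contradiction (subst (f u <_) once-sink lt) (λ ())
          reaches-b : x u + (deg t u + received f u) ≡ b u
          reaches-b = trans (sym (+-assoc (x u) _ _))
                            (trans (cong (_+ received f u) (sym (A≡ u u≢t)))
                                   (sym (unfired-outcome ρ (n<1⇒n≡0 (subst (f u <_) (once-≢ u≢t) lt)))))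
      all-once : f ≗ once
      all-once w = ≤-antisym (within w) (≮⇒≥ (λ lt → x-unforbidden unburnt (w , <⇒<ᵇ lt) forbidden))
      b≡x : ∀ v → v ≢ t → b v ≡ x v
      b≡x v v≢t = +-cancelʳ-≡ (out v) (b v) (x v) (begin
        b v + out v                        ≡⟨ cong (b v +_) (sym (trans (cong (_* out v) (trans (all-once v) (once-≢ v≢t))) (*-identityˡ (out v)))) ⟩
        b v + f v * out v                  ≡⟨ state-equation ρ v ⟩
        A v + received f v                 ≡⟨ cong₂ _+_ (A≡ v v≢t) (received-cong all-once v) ⟩
        (x v + deg t v) + received once v  ≡⟨ +-assoc (x v) _ _ ⟩
        x v + (deg t v + received once v)  ≡⟨ cong (x v +_) (received-once v) ⟩
        x v + out v                        ∎)
        where open ≡-Reasoning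

  -- x after k firings of t; the chips on t are irrelevant, as t never fires again.
  pumped : ℕ → Chips
  pumped k v = x v + k * deg t v

  pumped-relaxes : ∀ k {B : Chips} → (∀ v → v ≢ t → B v ≡ x v) →
                   Σ Chips λ b → Σ (Run (λ v → B v + k * deg t v) b) λ ρ →
                     firings ρ ≗ (λ v → k * once v) × (∀ v → v ≢ t → b v ≡ x v)
  pumped-relaxes zero {B} B≡x =
    _ , stop (λ _ → refl) , (λ _ → refl) , λ v v≢t → trans (+-identityʳ (B v)) (B≡x v v≢t)
  pumped-relaxes (suc k) {B} B≡x with burn {λ v → B v + deg t v} (λ v v≢t → cong (_+ deg t v) (B≡x v v≢t))
  ... | b₁ , ρ₁ , ρ₁-once , b₁≡x with shift ρ₁ (λ v → k * deg t v) | pumped-relaxes k b₁≡x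
  ...   | ρ₁' , same | b , ρ , ρ-count , b≡x = b , first ++ ρ , count , b≡x
    where
      reassoc : ∀ v → (B v + deg t v) + k * deg t v ≡ B v + suc k * deg t v
      reassoc v = +-assoc (B v) (deg t v) _
      first : Run (λ v → B v + suc k * deg t v) (λ v → b₁ v + k * deg t v)
      first = Run-respˡ reassoc ρ₁'
      count : ∀ v → firings (first ++ ρ) v ≡ suc k * once v
      count v = trans (firings-++ first ρ v)
                      (cong₂ _+_ (trans (firings-respˡ reassoc ρ₁' v) (trans (same v) (ρ₁-once v))) (ρ-count v))

  Loadable : (Fin (suc m) → Bool) → Set
  Loadable S = ∀ B → Σ ℕ λ k → Σ Chips λ z → Σ (Run (pumped k) z) λ π →
                 firings π t ≡ 0 × (∀ v → T (S v) → v ≢ t → B ≤ z v)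

  Loadable-⊆ : ∀ {S S'} → (∀ v → T (S' v) → T (S v)) → Loadable S → Loadable S'
  Loadable-⊆ S'⊆S loadable B with loadable B
  ... | k , z , π , πt , full = k , z , π , πt , λ v v∈S' → full v (S'⊆S v v∈S')

  insert : Fin (suc m) → (Fin (suc m) → Bool) → Fin (suc m) → Bool
  insert v S w = isYes (w ≟ v) ∨ S w

  insert-cases : ∀ {v S w} → T (insert v S w) → w ≡ v ⊎ T (S w)
  insert-cases {v} {S} {w} p with w ≟ v
  ... | yes w≡v = inj₁ w≡v
  ... | no _    = inj₂ p

  load-from-sink : ∀ {S v} → Loadable S → 0 < deg t v → Loadable (insert v S)
  load-from-sink {S} {v} loadable arc B with loadable B
  ... | k , z , π , πt , full with shift π (λ w → B * deg t w)
  ...   | π' , same = k + B , _ , Run-respˡ distrib π' , trans (firings-respˡ distrib π' t) (trans (same t) πt) , full'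
    where
      distrib : ∀ w → pumped k w + B * deg t w ≡ pumped (k + B) w
      distrib w = trans (+-assoc (x w) _ _) (cong (x w +_) (sym (*-distribʳ-+ (deg t w) k B)))
      full' : ∀ w → T (insert v S w) → w ≢ t → B ≤ z w + B * deg t w
      full' w p w≢t with insert-cases {v} {S} p
      ... | inj₁ refl = ≤-trans (m≤m*n B (deg t w) {{>-nonZero arc}}) (m≤n+m _ _)
      ... | inj₂ w∈S  = ≤-trans (full w w∈S w≢t) (m≤m+n _ _)

  load-along-arc : ∀ {S u v} → Loadable S → T (S u) → u ≢ t → 0 < deg u v → Loadable (insert v S)
  load-along-arc {S} {u} {v} loadable u∈S u≢t arc B with loadable (B * out u + B)
  ... | k , z , π , πt , full with fire-repeatedly u B (≤-trans (m≤m+n _ _) (full u u∈S u≢t))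
  ...   | z' , ρ , ρ-count = k , z' , π ++ ρ , πρt , full'
    where
      outcome : ∀ w → z' w + (δ u w * B) * out w ≡ z w + B * deg u w
      outcome w = trans (cong (λ f → z' w + f * out w) (sym (ρ-count w)))
                        (trans (state-equation ρ w) (cong (z w +_) (trans (received-cong ρ-count w) (received-δ* u B w))))
      πρt : firings (π ++ ρ) t ≡ 0
      πρt = trans (firings-++ π ρ t) (cong₂ _+_ πt (trans (ρ-count t) (cong (_* B) (δ-≢ u≢t))))
      gains : ∀ w → u ≢ w → z w + B * deg u w ≡ z' w
      gains w u≢w = trans (sym (outcome w)) (trans (cong (λ k → z' w + (k * B) * out w) (δ-≢ u≢w)) (+-identityʳ _))
      keeps : B ≤ z' u
      keeps = +-cancelʳ-≤ (B * out u) B (z' u) (begin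
        B + B * out u              ≡⟨ +-comm B _ ⟩
        B * out u + B              ≤⟨ full u u∈S u≢t ⟩
        z u                        ≡⟨ sym (trans (cong (λ d → z u + B * d) (noLoops u)) (trans (cong (z u +_) (*-zeroʳ B)) (+-identityʳ _))) ⟩
        z u + B * deg u u          ≡⟨ sym (outcome u) ⟩
        z' u + (δ u u * B) * out u ≡⟨ cong (λ k → z' u + (k * B) * out u) (δ-refl u) ⟩
        z' u + (1 * B) * out u     ≡⟨ cong (λ k → z' u + k * out u) (*-identityˡ B) ⟩
        z' u + B * out u           ∎)
        where open ≤-Reasoning
      full' : ∀ w → T (insert v S w) → w ≢ t → B ≤ z' w
      full' w p w≢t with u ≟ w | insert-cases {v} {S} p
      ... | yes refl | _        = keeps
      ... | no u≢w   | inj₁ refl = ≤-trans (m≤m*n B (deg u w) {{>-nonZero arc}}) (≤-trans (m≤n+m _ _) (≤-reflexive (gains w u≢w)))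
      ... | no u≢w   | inj₂ w∈S = ≤-trans (m≤n+m B _) (≤-trans (full w w∈S w≢t) (≤-trans (m≤m+n _ _) (≤-reflexive (gains w u≢w))))

  load-grow : ∀ {S} → T (S t) → Loadable S → ∀ {v₀} → ¬ T (S v₀) →
              ∃ λ v → ¬ T (S v) × Loadable (insert v S)
  load-grow {S} t∈S loadable {v₀} v₀∉S with unforbidden-witness (not ∘ S) (v₀ , T-not v₀∉S)
  ... | v , v∉S' , inflow≤x with inflow-pos S v (m≤o<m+n⇒0<n inflow≤x (subst (x v <_) (sym split) (x-stable v v≢t)))
    where
      v≢t : v ≢ t
      v≢t refl = T-not⁻ v∉S' t∈S
      split : inflow (not ∘ S) v + inflow S v ≡ out v
      split = trans (inflow-complement S v) (in≡out v)
  ...   | u , u∈S , arc with u ≟ t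
  ...     | yes refl = v , T-not⁻ v∉S' , load-from-sink loadable arc
  ...     | no u≢t   = v , T-not⁻ v∉S' , load-along-arc loadable u∈S u≢t arc

  missing : (Fin (suc m) → Bool) → ℕ
  missing S = ∑ (λ v → if S v then 0 else 1)

  missing-insert : ∀ {S v} → ¬ T (S v) → missing (insert v S) < missing S
  missing-insert {S} {v} v∉S = ∑-mono-< fewer v strict
    where
      fewer : ∀ w → (if insert v S w then 0 else 1) ≤ (if S w then 0 else 1)
      fewer w with w ≟ v
      ... | yes _ = z≤n
      ... | no _  = ≤-refl
      strict : (if insert v S v then 0 else 1) < (if S v then 0 else 1)
      strict with v ≟ v
      ... | yes _  = if-false-pos (S v) v∉S
      ... | no v≢v = contradiction refl v≢v

  loadable-all : ∀ fuel {S} → missing S ≤ fuel → T (S t) → Loadable S → Loadable (λ _ → true)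
  loadable-all fuel {S} bound t∈S loadable with any? (λ v → ¬? (T? (S v)))
  ... | no complete = Loadable-⊆ (λ v _ → decidable-stable (T? (S v)) (λ v∉S → complete (v , v∉S))) loadable
  ... | yes (_ , v₀∉S) with load-grow t∈S loadable v₀∉S
  ...   | v , v∉S , loadable' with fuel
  ...     | zero       = contradiction (<-≤-trans (missing-insert {S} {v} v∉S) bound) (λ ())
  ...     | suc fuel'  = loadable-all fuel' (≤-pred (≤-trans (missing-insert {S} {v} v∉S) bound)) (T-∨ʳ t∈S) loadable'

  loadable : Loadable (λ _ → true)
  loadable = loadable-all _ {λ w → isYes (w ≟ t)} ≤-refl (fromWitness refl) λ B →
    0 , pumped 0 , stop (λ _ → refl) , refl , λ v v≡t v≢t → contradiction (toWitness v≡t) v≢t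

  recurrent : Recurrent G t (restrict G t x)
  recurrent = (λ j → x-stable (punchIn t j) (punchInᵢ≢i t j)) , reach
    where
      reach : ∀ d → ∃ λ d' → Stabilizes G t (λ j → d j + d' j) (restrict G t x)
      reach d with loadable (∑ d)
      ... | k , z , π , πt , full with pumped-relaxes k {x} (λ _ _ → refl)
      ...   | y , ρ , ρ-count , y≡x with extend-to-stable ρ ρt y-stable π πt
        where
          ρt : firings ρ t ≡ 0
          ρt = trans (ρ-count t) (trans (cong (k *_) once-sink) (*-zeroʳ k))
          y-stable : ∀ v → v ≢ t → y v < out v
          y-stable v v≢t = subst (_< out v) (sym (y≡x v v≢t)) (x-stable v v≢t)
      ...     | y' , σ , σt , y'≡y with run⇒confSteps σ σt (λ j → d j + (z (punchIn t j) ∸ d j)) fill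
        where
          fill : ∀ j → d j + (z (punchIn t j) ∸ d j) ≡ z (punchIn t j)
          fill j = m+[n∸m]≡n (≤-trans (≤-∑ d j) (full (punchIn t j) _ (punchInᵢ≢i t j)))
      ...       | e , steps , e≡y' = (λ j → z (punchIn t j) ∸ d j) , e , steps , e-stable , e≡x
        where
          e≡x : ∀ j → e j ≡ x (punchIn t j)
          e≡x j = trans (e≡y' j) (trans (y'≡y _) (y≡x _ (punchInᵢ≢i t j)))
          e-stable : Stable G t e
          e-stable j = subst (_< out (punchIn t j)) (sym (e≡x j)) (x-stable (punchIn t j) (punchInᵢ≢i t j))

lemma8 : ∀ {m : ℕ} (G : Digraph (suc m)) → Eulerian G →
         (s₁ s₂ : Fin (suc m)) → s₁ ≢ s₂ →
         (c : Config G) → Recurrent G s₁ c → (i : ℕ) →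
         (x : Fin (suc m) → ℕ) → StabAt G s₂ (cbar G s₁ c i) x →
         Recurrent G s₂ (restrict G s₂ x) × outdeg G s₂ ≤ x s₂
lemma8 G (_ , in≡out) s t s≢t c c-recurrent i x (z , steps , z-stable , z≡x) with Sink.mapSteps⇒run G steps
... | ρ , ρt = recurrent , sink-loaded
  where
    open Firing G
    open Sink G
    x-stable : ∀ v → v ≢ t → x v < out v
    x-stable v v≢t = subst (_< out v) (z≡x v) (z-stable v v≢t)
    s-fired : firings ρ s ≢ 0
    s-fired s-unfired = <⇒≱ (z-stable s s≢t) (begin
      out s              ≤⟨ m≤m+n (out s) i ⟩
      out s + i          ≡⟨ sym (cbar-sink s c i) ⟩
      cbar G s c i s     ≤⟨ unfired-gains ρ s-unfired ⟩
      z s                ∎)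
      where open ≤-Reasoning
    x-unforbidden : ∀ U → ∃ (λ v → T (U v)) → ¬ Forbidden x U
    x-unforbidden U nonempty F =
      recurrent-unforbidden c-recurrent (cbar-punchIn s c i) (s-fired ∘ proj₁ ∘ unfired⁻ {U} {firings ρ})
                            (forbidden-nonempty ρ F-z nonempty) (forbidden-backward ρ F-z)
      where
        F-z : Forbidden z U
        F-z = Forbidden-resp (λ v _ → sym (z≡x v)) F
    open BurningCriterion G in≡out t x x-stable x-unforbidden using (recurrent; sink-loaded)
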